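{- Let $p\geq 2$ be an integer and let $r\in\{1,\ldots,p-1\}$. Define integers $D_{p,r}(n)$, $n\in\mathbb{N}$, by the power series expansion $$\prod_{m=0}^{\infty}\left(1-x^{p^{m}}\right)^{r}=\sum_{n=0}^{\infty}D_{p,r}(n)x^{n}.$$ Then for every $n\in\mathbb{N}$, $$D_{p,r}(n)=\prod_{i=0}^{p-1}(-1)^{iN_{p}(i,n)}\binom{r}{i}^{N_{p}(i,n)},$$ with the conventions $\binom{a}{b}=0$ for $b>a$ and $0^0=1$. Moreover, for every $j\in\{0,\ldots,p-1\}$ and every $n\in\mathbb{N}_{+}$, $$D_{p,r}(pn+j)=(-1)^{j}\binom{r}{j}D_{p,r}(n).$$
   Context: $\mathbb{N}=\{0,1,2,\ldots\}$ and $\mathbb{N}_{+}=\{1,2,\ldots\}$. For an integer $p\geq 2$, $i\in\{0,\ldots,p-1\}$ and $n\in\mathbb{N}$, $N_{p}(i,n)$ denotes the number of digits equal to $i$ in the (unique) base-$p$ representation $n=\sum_{j=0}^{k}\varepsilon_j p^j$, $\varepsilon_j\in\{0,\ldots,p-1\}$ (with $N_p(i,0)=0$ for all $i$). -}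

module Defs where

open import Data.Nat as ℕ using (ℕ; zero; suc; NonZero; _≡ᵇ_)
open import Data.Nat.DivMod using (_/_; _%_)
open import Data.Nat.Combinatorics using (_C_)
open import Data.Integer as ℤ using (ℤ; +_; -_)
open import Data.Bool using (if_then_else_)
open import Data.List using (List; []; _∷_)

Series : Set
Series = ℕ → ℤ

sumTo : ℕ → (ℕ → ℤ) → ℤ
sumTo zero    f = f 0
sumTo (suc n) f = sumTo n f ℤ.+ f (suc n)

_⊛_ : Series → Series → Series
(f ⊛ g) n = sumTo n (λ k → f k ℤ.* g (n ℕ.∸ k))

oneS : Series
oneS zero    = + 1
oneS (suc _) = + 0

monoS : ℕ → Series
monoS e n = if n ≡ᵇ e then + 1 else + 0

oneMinusX^ : ℕ → Series
oneMinusX^ e n = oneS n ℤ.- monoS e n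

powS : Series → ℕ → Series
powS f zero    = oneS
powS f (suc k) = f ⊛ powS f k

partialProd : ℕ → ℕ → ℕ → Series
partialProd p r zero    = oneS
partialProd p r (suc M) = partialProd p r M ⊛ powS (oneMinusX^ (p ℕ.^ M)) r

-- Since every factor with m ≥ M (p^M > n) is ≡ 1 mod x^{n+1},
-- the coefficient of x^n equals that of the partial product over m ∈ {0,…,n}
-- (as p ≥ 2 gives p^(n+1) > n).
D : ℕ → ℕ → ℕ → ℤ
D p r n = partialProd p r (suc n) n

-- base-p digits (least significant first); fuel n suffices since n/p < n for n > 0
digitsAux : (p : ℕ) → .{{NonZero p}} → ℕ → ℕ → List ℕ
digitsAux p zero       n       = []
digitsAux p (suc fuel) zero    = []
digitsAux p (suc fuel) (suc n) = (suc n % p) ∷ digitsAux p fuel (suc n / p)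

digits : (p : ℕ) → .{{NonZero p}} → ℕ → List ℕ
digits p n = digitsAux p n n

countEq : ℕ → List ℕ → ℕ
countEq i []       = 0
countEq i (d ∷ ds) = (if i ≡ᵇ d then 1 else 0) ℕ.+ countEq i ds

-- N_p(i,n): number of digits equal to i in the base-p representation of n (N_p(i,0) = 0)
N : (p : ℕ) → .{{NonZero p}} → ℕ → ℕ → ℕ
N p i n = countEq i (digits p n)

prodBelow : ℕ → (ℕ → ℤ) → ℤ
prodBelow zero    f = + 1
prodBelow (suc k) f = prodBelow k f ℤ.* f k

minusOne : ℤ
minusOne = - (+ 1)

{-# OPTIONS --safe #-}
-- Let Π_M = ∏_{m<M} (1 - x^{p^m})^r. Substituting x ↦ x^p shifts the factors, so
-- Π_{M+1}(x) = (1 - x)^r · Π_M(x^p). As r < p, (1 - x)^r = Σ_{j<p} (-1)^j C(r,j) x^j has degree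
-- below p, hence the coefficient of x^{pn+j} in Π_{M+1} is (-1)^j C(r,j) times that of x^n in Π_M.
-- Peeling off the base-p digits of n one at a time turns D_{p,r}(n) into the product over its digits.
module Submission where

open import Defs
open import Data.Nat using (ℕ; NonZero; _≤_; _<_; _*_; _+_)
open import Data.Nat.Combinatorics using (_C_)
open import Data.Integer as ℤ using (ℤ; +_)
open import Data.Product using (_×_)
open import Relation.Binary.PropositionalEquality using (_≡_)

open import Data.Bool using (true; false)
open import Data.List using (_∷_)
open import Data.Nat using (zero; suc; _∸_; _≡ᵇ_; _^_; z≤n; s≤s)
open import Data.Nat.Combinatorics using (k>n⇒nCk≡0; nCk+nC[k+1]≡[n+1]C[k+1])
open import Data.Nat.Divisibility using (n∣m*n)
open import Data.Nat.DivMod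
  using (_/_; _%_; m≡m%n+[m/n]*n; m%n<n; m/n<m; m<n*o⇒m/o<n; [m+kn]%n≡m%n; m<n⇒m%n≡m;
         m<n⇒m/n≡0; m*n/n≡m; +-distrib-/-∣ʳ)
import Data.Nat.Properties as ℕₚ
import Data.Integer.Properties as ℤₚ
open import Data.Integer.Tactic.RingSolver using (solve-∀)
open import Data.Product using (_,_)
open import Function using (_∘_)
open import Relation.Binary.PropositionalEquality
  using (_≢_; refl; sym; trans; cong; cong₂; subst; module ≡-Reasoning)
open import Relation.Nullary.Decidable using (yes; no; dec-true; dec-false)

open ≡-Reasoning

sumTo-cong : ∀ n {F G : ℕ → ℤ} → (∀ k → k ≤ n → F k ≡ G k) → sumTo n F ≡ sumTo n G
sumTo-cong zero    F≗G = F≗G 0 z≤n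
sumTo-cong (suc n) F≗G =
  cong₂ ℤ._+_ (sumTo-cong n (λ k k≤n → F≗G k (ℕₚ.m≤n⇒m≤1+n k≤n))) (F≗G (suc n) ℕₚ.≤-refl)

sumTo-suc : ∀ n (F : ℕ → ℤ) → sumTo (suc n) F ≡ F 0 ℤ.+ sumTo n (F ∘ suc)
sumTo-suc zero    F = refl
sumTo-suc (suc n) F = trans (cong (ℤ._+ F (suc (suc n))) (sumTo-suc n F)) (ℤₚ.+-assoc (F 0) _ _)

sumTo-reverse : ∀ n (F : ℕ → ℤ) → sumTo n F ≡ sumTo n (λ k → F (n ∸ k))
sumTo-reverse zero    F = refl
sumTo-reverse (suc n) F = begin
  sumTo n F ℤ.+ F (suc n)                  ≡⟨ cong (ℤ._+ F (suc n)) (sumTo-reverse n F) ⟩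
  sumTo n (λ k → F (n ∸ k)) ℤ.+ F (suc n)  ≡⟨ ℤₚ.+-comm _ (F (suc n)) ⟩
  F (suc n) ℤ.+ sumTo n (λ k → F (n ∸ k))  ≡⟨ sumTo-suc n (λ k → F (suc n ∸ k)) ⟨
  sumTo (suc n) (λ k → F (suc n ∸ k))      ∎

*-distribˡ-sumTo : ∀ n c (F : ℕ → ℤ) → c ℤ.* sumTo n F ≡ sumTo n (λ k → c ℤ.* F k)
*-distribˡ-sumTo zero    c F = refl
*-distribˡ-sumTo (suc n) c F = trans (ℤₚ.*-distribˡ-+ c (sumTo n F) (F (suc n)))
  (cong (ℤ._+ (c ℤ.* F (suc n))) (*-distribˡ-sumTo n c F))

sumTo-truncate : ∀ m (F : ℕ → ℤ) → (∀ i → m < i → F i ≡ + 0) →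
  ∀ n → m ≤ n → sumTo n F ≡ sumTo m F
sumTo-truncate m F vanish zero    z≤n = refl
sumTo-truncate m F vanish (suc n) m≤1+n with m ℕₚ.≟ suc n
... | yes refl = refl
... | no m≢1+n = trans (cong₂ ℤ._+_ (sumTo-truncate m F vanish n m≤n) (vanish (suc n) (s≤s m≤n)))
                       (ℤₚ.+-identityʳ _)
  where m≤n = ℕₚ.m<1+n⇒m≤n (ℕₚ.≤∧≢⇒< m≤1+n m≢1+n)

⊛-comm : ∀ f g n → (f ⊛ g) n ≡ (g ⊛ f) n
⊛-comm f g n = trans (sumTo-reverse n _) (sumTo-cong n λ k k≤n →
  trans (cong (λ i → f (n ∸ k) ℤ.* g i) (ℕₚ.m∸[m∸n]≡n k≤n)) (ℤₚ.*-comm (f (n ∸ k)) (g k)))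

oneS-⊛ : ∀ f n → (oneS ⊛ f) n ≡ f n
oneS-⊛ f n = trans (sumTo-truncate 0 _ (λ { (suc i) _ → refl }) n z≤n) (ℤₚ.*-identityˡ (f n))

oneMinusX-⊛-suc : ∀ f k → (oneMinusX^ 1 ⊛ f) (suc k) ≡ f (suc k) ℤ.- f k
oneMinusX-⊛-suc f k = trans (sumTo-truncate 1 _ vanish (suc k) (s≤s z≤n)) (difference (f (suc k)) (f k))
  where
  vanish : ∀ i → 1 < i → oneMinusX^ 1 i ℤ.* f (suc k ∸ i) ≡ + 0
  vanish (suc zero)    (s≤s ())
  vanish (suc (suc i)) _ = refl
  difference : ∀ a b → + 1 ℤ.* a ℤ.+ ℤ.- (+ 1) ℤ.* b ≡ a ℤ.- b
  difference = solve-∀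

signedBinomial : ℕ → ℕ → ℤ
signedBinomial r i = minusOne ℤ.^ i ℤ.* + (r C i)

powS-oneMinusX : ∀ r k → powS (oneMinusX^ 1) r k ≡ signedBinomial r k
powS-oneMinusX zero    zero    = refl
powS-oneMinusX zero    (suc k) = sym (ℤₚ.*-zeroʳ (minusOne ℤ.^ suc k))
powS-oneMinusX (suc r) zero    = trans (ℤₚ.*-identityˡ _) (powS-oneMinusX r 0)
powS-oneMinusX (suc r) (suc k) = begin
  (oneMinusX^ 1 ⊛ powS (oneMinusX^ 1) r) (suc k)
    ≡⟨ oneMinusX-⊛-suc (powS (oneMinusX^ 1) r) k ⟩
  powS (oneMinusX^ 1) r (suc k) ℤ.- powS (oneMinusX^ 1) r k
    ≡⟨ cong₂ ℤ._-_ (powS-oneMinusX r (suc k)) (powS-oneMinusX r k) ⟩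
  minusOne ℤ.* s ℤ.* + (r C suc k) ℤ.- s ℤ.* + (r C k)
    ≡⟨ collect s (+ (r C k)) (+ (r C suc k)) ⟩
  minusOne ℤ.* s ℤ.* (+ (r C k) ℤ.+ + (r C suc k))
    ≡⟨ cong (minusOne ℤ.* s ℤ.*_) (trans (sym (ℤₚ.pos-+ (r C k) (r C suc k)))
                                         (cong +_ (nCk+nC[k+1]≡[n+1]C[k+1] r k))) ⟩
  signedBinomial (suc r) (suc k) ∎
  where
  s = minusOne ℤ.^ k
  collect : ∀ s a b → ℤ.- (+ 1) ℤ.* s ℤ.* b ℤ.- s ℤ.* a ≡ ℤ.- (+ 1) ℤ.* s ℤ.* (a ℤ.+ b)
  collect = solve-∀

powS-oneMinusX-vanishes : ∀ {r k} → r < k → powS (oneMinusX^ 1) r k ≡ + 0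
powS-oneMinusX-vanishes {r} {k} r<k = begin
  powS (oneMinusX^ 1) r k      ≡⟨ powS-oneMinusX r k ⟩
  minusOne ℤ.^ k ℤ.* + (r C k) ≡⟨ cong (λ c → minusOne ℤ.^ k ℤ.* + c) (k>n⇒nCk≡0 r<k) ⟩
  minusOne ℤ.^ k ℤ.* + 0       ≡⟨ ℤₚ.*-zeroʳ (minusOne ℤ.^ k) ⟩
  + 0                          ∎

≡ᵇ-refl : ∀ n → (n ≡ᵇ n) ≡ true
≡ᵇ-refl n = dec-true (n ℕₚ.≟ n) refl

≢⇒≡ᵇ-false : ∀ {m n} → m ≢ n → (m ≡ᵇ n) ≡ false
≢⇒≡ᵇ-false {m} {n} = dec-false (m ℕₚ.≟ n)

[m*n+j]%m≡j : ∀ m .{{_ : NonZero m}} n {j} → j < m → (m * n + j) % m ≡ j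
[m*n+j]%m≡j m n {j} j<m = begin
  (m * n + j) % m ≡⟨ cong (_% m) (trans (ℕₚ.+-comm (m * n) j) (cong (_+_ j) (ℕₚ.*-comm m n))) ⟩
  (j + n * m) % m ≡⟨ [m+kn]%n≡m%n j n m ⟩
  j % m           ≡⟨ m<n⇒m%n≡m j<m ⟩
  j               ∎

[m*n+j]/m≡n : ∀ m .{{_ : NonZero m}} n {j} → j < m → (m * n + j) / m ≡ n
[m*n+j]/m≡n m n {j} j<m = begin
  (m * n + j) / m   ≡⟨ cong (_/ m) (trans (ℕₚ.+-comm (m * n) j) (cong (_+_ j) (ℕₚ.*-comm m n))) ⟩
  (j + n * m) / m   ≡⟨ +-distrib-/-∣ʳ j (n∣m*n n) ⟩
  j / m + n * m / m ≡⟨ cong₂ _+_ (m<n⇒m/n≡0 j<m) (m*n/n≡m n m) ⟩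
  n                 ∎

n<m^n : ∀ {m} → 1 < m → ∀ n → n < m ^ n
n<m^n 1<m zero    = s≤s z≤n
n<m^n {m} 1<m (suc n) = ℕₚ.≤-<-trans (n<m^n 1<m n) (ℕₚ.^-monoʳ-< m 1<m (ℕₚ.n<1+n n))

digitsAux-fuel : ∀ {p} .{{_ : NonZero p}} → 1 < p →
  ∀ f₁ f₂ x → x ≤ f₁ → x ≤ f₂ → digitsAux p f₁ x ≡ digitsAux p f₂ x
digitsAux-fuel _ zero    zero    _     _   _   = refl
digitsAux-fuel _ zero    (suc _) .zero z≤n _   = refl
digitsAux-fuel _ (suc _) zero    .zero _   z≤n = refl
digitsAux-fuel _ (suc _) (suc _) zero  _   _   = refl
digitsAux-fuel {p} 1<p (suc f₁) (suc f₂) (suc x) (s≤s x≤f₁) (s≤s x≤f₂) =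
  cong (suc x % p ∷_)
       (digitsAux-fuel 1<p f₁ f₂ (suc x / p) (ℕₚ.≤-trans x/p≤x x≤f₁) (ℕₚ.≤-trans x/p≤x x≤f₂))
  where x/p≤x = ℕₚ.m<1+n⇒m≤n (m/n<m (suc x) p 1<p)

digits-suc : ∀ {p} .{{_ : NonZero p}} → 1 < p → ∀ m →
  digits p (suc m) ≡ suc m % p ∷ digits p (suc m / p)
digits-suc {p} 1<p m = cong (suc m % p ∷_)
  (digitsAux-fuel 1<p m (suc m / p) (suc m / p) (ℕₚ.m<1+n⇒m≤n (m/n<m (suc m) p 1<p)) ℕₚ.≤-refl)

prodBelow-cong : ∀ k {F G : ℕ → ℤ} → (∀ i → i < k → F i ≡ G i) → prodBelow k F ≡ prodBelow k G
prodBelow-cong zero    F≗G = refl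
prodBelow-cong (suc k) F≗G =
  cong₂ ℤ._*_ (prodBelow-cong k (λ i i<k → F≗G i (ℕₚ.m<n⇒m<1+n i<k))) (F≗G k ℕₚ.≤-refl)

prodBelow-ones : ∀ k {F : ℕ → ℤ} → (∀ i → F i ≡ + 1) → prodBelow k F ≡ + 1
prodBelow-ones zero    F≗1 = refl
prodBelow-ones (suc k) F≗1 = cong₂ ℤ._*_ (prodBelow-ones k F≗1) (F≗1 k)

prodBelow-scale-at : ∀ a d {F G : ℕ → ℤ} → (∀ i → i ≢ d → G i ≡ F i) → G d ≡ a ℤ.* F d →
  ∀ k → d < k → prodBelow k G ≡ a ℤ.* prodBelow k F
prodBelow-scale-at a d {F} {G} G≗F Gd (suc k) d<1+k with d ℕₚ.≟ k
... | yes refl = trans (cong₂ ℤ._*_ (prodBelow-cong k (λ i i<k → G≗F i (ℕₚ.<⇒≢ i<k))) Gd)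
                       (swap (prodBelow k F) a (F k))
  where
  swap : ∀ x a y → x ℤ.* (a ℤ.* y) ≡ a ℤ.* (x ℤ.* y)
  swap = solve-∀
... | no d≢k = trans (cong₂ ℤ._*_ (prodBelow-scale-at a d G≗F Gd k d<k) (G≗F k (d≢k ∘ sym)))
                     (ℤₚ.*-assoc a (prodBelow k F) (F k))
  where d<k = ℕₚ.≤∧≢⇒< (ℕₚ.m<1+n⇒m≤n d<1+k) d≢k

prodBelow-countEq-∷ : (g : ℕ → ℕ → ℤ) (w : ℕ → ℤ) → (∀ i c → g i (suc c) ≡ w i ℤ.* g i c) →
  ∀ {k d} ds → d < k →
  prodBelow k (λ i → g i (countEq i (d ∷ ds))) ≡ w d ℤ.* prodBelow k (λ i → g i (countEq i ds))
prodBelow-countEq-∷ g w g-suc {k} {d} ds d<k = prodBelow-scale-at (w d) d other here k d<k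
  where
  other : ∀ i → i ≢ d → g i (countEq i (d ∷ ds)) ≡ g i (countEq i ds)
  other i i≢d rewrite ≢⇒≡ᵇ-false i≢d = refl
  here : g d (countEq d (d ∷ ds)) ≡ w d ℤ.* g d (countEq d ds)
  here rewrite ≡ᵇ-refl d = g-suc d (countEq d ds)

digitFactor : ℕ → ℕ → ℕ → ℤ
digitFactor r i c = minusOne ℤ.^ (i * c) ℤ.* (+ (r C i)) ℤ.^ c

digitFactor-suc : ∀ r i c → digitFactor r i (suc c) ≡ signedBinomial r i ℤ.* digitFactor r i c
digitFactor-suc r i c = begin
  minusOne ℤ.^ (i * suc c) ℤ.* b ℤ.^ suc c
    ≡⟨ cong (λ e → minusOne ℤ.^ e ℤ.* b ℤ.^ suc c) (ℕₚ.*-suc i c) ⟩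
  minusOne ℤ.^ (i + i * c) ℤ.* (b ℤ.* b ℤ.^ c)
    ≡⟨ cong (ℤ._* (b ℤ.* b ℤ.^ c)) (ℤₚ.^-distribˡ-+-* minusOne i (i * c)) ⟩
  minusOne ℤ.^ i ℤ.* minusOne ℤ.^ (i * c) ℤ.* (b ℤ.* b ℤ.^ c)
    ≡⟨ interchange (minusOne ℤ.^ i) (minusOne ℤ.^ (i * c)) b (b ℤ.^ c) ⟩
  minusOne ℤ.^ i ℤ.* b ℤ.* (minusOne ℤ.^ (i * c) ℤ.* b ℤ.^ c) ∎
  where
  b = + (r C i)
  interchange : ∀ s t x y → s ℤ.* t ℤ.* (x ℤ.* y) ≡ s ℤ.* x ℤ.* (t ℤ.* y)
  interchange = solve-∀

digitProduct : (p : ℕ) → .{{NonZero p}} → ℕ → ℕ → ℤ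
digitProduct p r n = prodBelow p (λ i → digitFactor r i (N p i n))

digitProduct-zero : ∀ p .{{_ : NonZero p}} r → digitProduct p r 0 ≡ + 1
digitProduct-zero p r = prodBelow-ones p (λ i → cong (λ e → minusOne ℤ.^ e ℤ.* + 1) (ℕₚ.*-zeroʳ i))

digitProduct-step : ∀ {p} .{{_ : NonZero p}} → 1 < p → ∀ r m →
  digitProduct p r m ≡ signedBinomial r (m % p) ℤ.* digitProduct p r (m / p)
digitProduct-step {p} 1<p r zero = begin
  digitProduct p r 0
    ≡⟨ ℤₚ.*-identityˡ _ ⟨
  signedBinomial r 0 ℤ.* digitProduct p r 0
    ≡⟨ cong₂ (λ j n → signedBinomial r j ℤ.* digitProduct p r n)
             (sym (m<n⇒m%n≡m 0<p)) (sym (m<n⇒m/n≡0 0<p)) ⟩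
  signedBinomial r (0 % p) ℤ.* digitProduct p r (0 / p) ∎
  where 0<p = ℕₚ.<-trans (s≤s z≤n) 1<p
digitProduct-step {p} 1<p r (suc m) =
  trans (cong (λ ds → prodBelow p (λ i → digitFactor r i (countEq i ds))) (digits-suc 1<p m))
        (prodBelow-countEq-∷ (digitFactor r) (signedBinomial r) (digitFactor-suc r)
                             (digits p (suc m / p)) (m%n<n (suc m) p))

digitProduct-[p*n+j] : ∀ {p} .{{_ : NonZero p}} → 1 < p → ∀ r n {j} → j < p →
  digitProduct p r (p * n + j) ≡ signedBinomial r j ℤ.* digitProduct p r n
digitProduct-[p*n+j] {p} 1<p r n {j} j<p = begin
  digitProduct p r (p * n + j)
    ≡⟨ digitProduct-step 1<p r (p * n + j) ⟩
  signedBinomial r ((p * n + j) % p) ℤ.* digitProduct p r ((p * n + j) / p)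
    ≡⟨ cong₂ (λ i m → signedBinomial r i ℤ.* digitProduct p r m)
             ([m*n+j]%m≡j p n j<p) ([m*n+j]/m≡n p n j<p) ⟩
  signedBinomial r j ℤ.* digitProduct p r n ∎

module Dilation (q : ℕ) where

  P : ℕ
  P = suc q

  -- X(x) = c(x) · Y(x^P) with c(x) = Σ_{j<P} c j x^j, read off coefficientwise.
  record Dilated (c : ℕ → ℤ) (Y X : Series) : Set where
    field coeff : ∀ n j → j < P → X (P * n + j) ≡ c j ℤ.* Y n
  open Dilated

  sumTo-multiples : (F : ℕ → ℤ) → (∀ a b → 0 < b → b < P → F (P * a + b) ≡ + 0) →
    ∀ n j → j < P → sumTo (P * n + j) F ≡ sumTo n (λ a → F (P * a))
  sumTo-multiples F vanish zero    zero    _ rewrite ℕₚ.*-zeroʳ P = refl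
  sumTo-multiples F vanish (suc n) zero    _ = begin
    sumTo (P * suc n + 0) F
      ≡⟨ cong (λ m → sumTo m F) (trans (ℕₚ.+-identityʳ _) endOfBlock) ⟩
    sumTo (P * n + q) F ℤ.+ F (suc (P * n + q))
      ≡⟨ cong₂ ℤ._+_ (sumTo-multiples F vanish n q ℕₚ.≤-refl) (cong F (sym endOfBlock)) ⟩
    sumTo (suc n) (λ a → F (P * a)) ∎
    where
    endOfBlock : P * suc n ≡ suc (P * n + q)
    endOfBlock = trans (ℕₚ.*-suc P n) (cong suc (ℕₚ.+-comm q (P * n)))
  sumTo-multiples F vanish n (suc j) 1+j<P = begin
    sumTo (P * n + suc j) F
      ≡⟨ cong (λ m → sumTo m F) (ℕₚ.+-suc (P * n) j) ⟩
    sumTo (P * n + j) F ℤ.+ F (suc (P * n + j))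
      ≡⟨ cong₂ ℤ._+_ (sumTo-multiples F vanish n j (ℕₚ.<-trans (ℕₚ.n<1+n j) 1+j<P))
                     (trans (cong F (sym (ℕₚ.+-suc (P * n) j))) (vanish n (suc j) (s≤s z≤n) 1+j<P)) ⟩
    sumTo n (λ a → F (P * a)) ℤ.+ + 0
      ≡⟨ ℤₚ.+-identityʳ _ ⟩
    sumTo n (λ a → F (P * a)) ∎

  ⊛-dilated : ∀ {Z W c Y X} → Dilated oneS Z W → Dilated c Y X → Dilated c (Z ⊛ Y) (W ⊛ X)
  coeff (⊛-dilated {Z} {W} {c} {Y} {X} W-dil X-dil) n j j<P = begin
    sumTo (P * n + j) (λ k → W k ℤ.* X (P * n + j ∸ k))   ≡⟨ sumTo-multiples _ offMultiple n j j<P ⟩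
    sumTo n (λ a → W (P * a) ℤ.* X (P * n + j ∸ P * a))   ≡⟨ sumTo-cong n onMultiple ⟩
    sumTo n (λ a → c j ℤ.* (Z a ℤ.* Y (n ∸ a)))           ≡⟨ *-distribˡ-sumTo n (c j) _ ⟨
    c j ℤ.* (Z ⊛ Y) n                                     ∎
    where
    offMultiple : ∀ a b → 0 < b → b < P → W (P * a + b) ℤ.* X (P * n + j ∸ (P * a + b)) ≡ + 0
    offMultiple a (suc b) _ b<P rewrite coeff W-dil a (suc b) b<P = refl
    complement : ∀ a → a ≤ n → P * n + j ∸ P * a ≡ P * (n ∸ a) + j
    complement a a≤n =
      trans (ℕₚ.+-∸-comm j (ℕₚ.*-monoʳ-≤ P a≤n)) (cong (_+ j) (sym (ℕₚ.*-distribˡ-∸ P n a)))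
    rearrange : ∀ z x y → (+ 1 ℤ.* z) ℤ.* (x ℤ.* y) ≡ x ℤ.* (z ℤ.* y)
    rearrange = solve-∀
    onMultiple : ∀ a → a ≤ n → W (P * a) ℤ.* X (P * n + j ∸ P * a) ≡ c j ℤ.* (Z a ℤ.* Y (n ∸ a))
    onMultiple a a≤n = begin
      W (P * a) ℤ.* X (P * n + j ∸ P * a)
        ≡⟨ cong₂ ℤ._*_ (trans (cong W (sym (ℕₚ.+-identityʳ (P * a)))) (coeff W-dil a 0 (s≤s z≤n)))
                       (cong X (complement a a≤n)) ⟩
      (+ 1 ℤ.* Z a) ℤ.* X (P * (n ∸ a) + j)
        ≡⟨ cong ((+ 1 ℤ.* Z a) ℤ.*_) (coeff X-dil (n ∸ a) j j<P) ⟩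
      (+ 1 ℤ.* Z a) ℤ.* (c j ℤ.* Y (n ∸ a))
        ≡⟨ rearrange (Z a) (c j) (Y (n ∸ a)) ⟩
      c j ℤ.* (Z a ℤ.* Y (n ∸ a)) ∎

  oneS-dilated : Dilated oneS oneS oneS
  coeff oneS-dilated zero    zero    _ rewrite ℕₚ.*-zeroʳ P = refl
  coeff oneS-dilated zero    (suc j) _ rewrite ℕₚ.*-zeroʳ P = refl
  coeff oneS-dilated (suc n) j       _ = sym (ℤₚ.*-zeroʳ (oneS j))

  P*n+j≢P*e : ∀ n j e → 0 < j → j < P → P * n + j ≢ P * e
  P*n+j≢P*e n (suc j) e _ 1+j<P eq = ℕₚ.0≢1+n (begin
    0                   ≡⟨ [m*n+j]%m≡j P e (s≤s z≤n) ⟨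
    (P * e + 0) % P     ≡⟨ cong (_% P) (trans (ℕₚ.+-identityʳ (P * e)) (sym eq)) ⟩
    (P * n + suc j) % P ≡⟨ [m*n+j]%m≡j P n 1+j<P ⟩
    suc j               ∎)

  monoS-dilated : ∀ e → Dilated oneS (monoS e) (monoS (P * e))
  coeff (monoS-dilated e) n zero _ rewrite ℕₚ.+-identityʳ (P * n) with n ℕₚ.≟ e
  ... | yes refl rewrite ≡ᵇ-refl (P * n) | ≡ᵇ-refl n = refl
  ... | no n≢e rewrite ≢⇒≡ᵇ-false n≢e | ≢⇒≡ᵇ-false (n≢e ∘ ℕₚ.*-cancelˡ-≡ n e P) = refl
  coeff (monoS-dilated e) n (suc j) 1+j<P
    rewrite ≢⇒≡ᵇ-false (P*n+j≢P*e n (suc j) e (s≤s z≤n) 1+j<P) = refl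

  oneMinusX^-dilated : ∀ e → Dilated oneS (oneMinusX^ e) (oneMinusX^ (P * e))
  coeff (oneMinusX^-dilated e) n j j<P
    rewrite coeff oneS-dilated n j j<P | coeff (monoS-dilated e) n j j<P = factor (oneS j) (oneS n) (monoS e n)
    where
    factor : ∀ a x y → a ℤ.* x ℤ.- a ℤ.* y ≡ a ℤ.* (x ℤ.- y)
    factor = solve-∀

  powS-dilated : ∀ {f g} → Dilated oneS f g → ∀ r → Dilated oneS (powS f r) (powS g r)
  powS-dilated g-dil zero    = oneS-dilated
  powS-dilated g-dil (suc r) = ⊛-dilated g-dil (powS-dilated g-dil r)

  oneMinusX^r-dilated : ∀ {r} → r < P → Dilated (signedBinomial r) oneS (powS (oneMinusX^ 1) r)
  coeff (oneMinusX^r-dilated {r} _) zero j _ rewrite ℕₚ.*-zeroʳ P =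
    trans (powS-oneMinusX r j) (sym (ℤₚ.*-identityʳ _))
  coeff (oneMinusX^r-dilated {r} r<P) (suc n) j _ =
    trans (powS-oneMinusX-vanishes (ℕₚ.<-≤-trans r<P P≤P*[1+n]+j)) (sym (ℤₚ.*-zeroʳ (signedBinomial r j)))
    where P≤P*[1+n]+j = ℕₚ.≤-trans (ℕₚ.m≤m*n P (suc n)) (ℕₚ.m≤m+n (P * suc n) j)

  partialProd-dilated : ∀ {r} → r < P → ∀ M →
    Dilated (signedBinomial r) (partialProd P r M) (partialProd P r (suc M))
  coeff (partialProd-dilated {r} r<P zero) n j j<P =
    trans (oneS-⊛ (powS (oneMinusX^ 1) r) (P * n + j)) (coeff (oneMinusX^r-dilated r<P) n j j<P)
  coeff (partialProd-dilated {r} r<P (suc M)) n j j<P = begin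
    partialProd P r (suc (suc M)) (P * n + j)
      ≡⟨ ⊛-comm (partialProd P r (suc M)) (factor (suc M)) (P * n + j) ⟩
    (factor (suc M) ⊛ partialProd P r (suc M)) (P * n + j)
      ≡⟨ coeff (⊛-dilated (powS-dilated (oneMinusX^-dilated (P ^ M)) r) (partialProd-dilated r<P M)) n j j<P ⟩
    signedBinomial r j ℤ.* (factor M ⊛ partialProd P r M) n
      ≡⟨ cong (signedBinomial r j ℤ.*_) (⊛-comm (factor M) (partialProd P r M) n) ⟩
    signedBinomial r j ℤ.* partialProd P r (suc M) n ∎
    where
    factor : ℕ → Series
    factor m = powS (oneMinusX^ (P ^ m)) r

  partialProd≡digitProduct : ∀ {r} → r < P → 1 < P → ∀ M m → m < P ^ M →
    partialProd P r M m ≡ digitProduct P r m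
  partialProd≡digitProduct {r} _   _   zero    zero    _         = sym (digitProduct-zero P r)
  partialProd≡digitProduct     _   _   zero    (suc m) (s≤s ())
  partialProd≡digitProduct {r} r<P 1<P (suc M) m m<P^[1+M] = begin
    partialProd P r (suc M) m
      ≡⟨ cong (partialProd P r (suc M)) m≡P*[m/P]+m%P ⟩
    partialProd P r (suc M) (P * (m / P) + m % P)
      ≡⟨ coeff (partialProd-dilated r<P M) (m / P) (m % P) (m%n<n m P) ⟩
    signedBinomial r (m % P) ℤ.* partialProd P r M (m / P)
      ≡⟨ cong (signedBinomial r (m % P) ℤ.*_) (partialProd≡digitProduct r<P 1<P M (m / P) m/P<P^M) ⟩
    signedBinomial r (m % P) ℤ.* digitProduct P r (m / P)
      ≡⟨ digitProduct-step 1<P r m ⟨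
    digitProduct P r m ∎
    where
    m≡P*[m/P]+m%P : m ≡ P * (m / P) + m % P
    m≡P*[m/P]+m%P =
      trans (m≡m%n+[m/n]*n m P) (trans (ℕₚ.+-comm (m % P) _) (cong (_+ m % P) (ℕₚ.*-comm (m / P) P)))
    m/P<P^M : m / P < P ^ M
    m/P<P^M = m<n*o⇒m/o<n (subst (m <_) (ℕₚ.*-comm P (P ^ M)) m<P^[1+M])

lemma2p1 : (p : ℕ) → .{{_ : NonZero p}} → 2 ≤ p → (r : ℕ) → 1 ≤ r → r < p →
    ((n : ℕ) → D p r n ≡ prodBelow p (λ i → (minusOne ℤ.^ (i * N p i n)) ℤ.* ((+ (r C i)) ℤ.^ N p i n)))
    × ((j : ℕ) → j < p → (n : ℕ) → 1 ≤ n → D p r (p * n + j) ≡ (minusOne ℤ.^ j) ℤ.* (+ (r C j)) ℤ.* D p r n)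
lemma2p1 p@(suc q) 2≤p r _ r<p = D≡digitProduct , recursion
  where
  open Dilation q
  D≡digitProduct : ∀ n → D p r n ≡ digitProduct p r n
  D≡digitProduct n =
    partialProd≡digitProduct r<p 2≤p (suc n) n (ℕₚ.<-trans (ℕₚ.n<1+n n) (n<m^n 2≤p (suc n)))
  -- The recursion holds for n = 0 too.
  recursion : ∀ j → j < p → (n : ℕ) → 1 ≤ n → D p r (p * n + j) ≡ signedBinomial r j ℤ.* D p r n
  recursion j j<p n _ = begin
    D p r (p * n + j)                         ≡⟨ D≡digitProduct (p * n + j) ⟩
    digitProduct p r (p * n + j)              ≡⟨ digitProduct-[p*n+j] 2≤p r n j<p ⟩
    signedBinomial r j ℤ.* digitProduct p r n ≡⟨ cong (signedBinomial r j ℤ.*_) (D≡digitProduct n) ⟨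
    signedBinomial r j ℤ.* D p r n            ∎
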